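{- Let $g\geq 2$, $h\ge 2$ and $t\ge 1$ be integers with $h>g^t(g-1)$. Then there exists a partition $\mathbb{N}=W_0\cup\cdots\cup W_{h-1}$ into pairwise disjoint sets such that each set $W_r$ ($0\le r\le h-1$) contains infinitely many intervals of at least $t$ consecutive integers, and every integer $n\geq h$ belongs to $hA_g(W_0)$, i.e. every integer $n\ge h$ can be written as $n=a_1+\cdots+a_h$ with $a_1,\dots,a_h\in A_g(W_0)$.
   Context: $\mathbb{N}$ denotes the set of all nonnegative integers. For a nonempty set $W\subseteq\mathbb{N}$ and an integer $g\ge 2$, $A_g(W)$ is the set of all numbers of the form $\sum_{f\in F}a_f g^f$, where $F$ is a finite nonempty subset of $W$ and $1\le a_f\le g-1$ for each $f\in F$. For a set $B$ of integers, $hB$ denotes the set of all sums $b_1+\cdots+b_h$ with $b_1,\dots,b_h\in B$. -}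

module Defs where

open import Data.Nat using (ℕ; _+_; _*_; _^_; _≤_; _∸_)
open import Data.Fin using (Fin; toℕ)
open import Data.List using (List; []; _∷_; map; length)
open import Data.Nat.ListAction using (sum)
open import Data.List.Relation.Unary.All using (All)
open import Data.List.Relation.Unary.Unique.Propositional using (Unique)
open import Data.Vec using (Vec) renaming (sum to vsum)
open import Data.Vec.Relation.Unary.All using () renaming (All to VAll)
open import Data.Product using (_×_; _,_; proj₁; proj₂; Σ; ∃)
open import Relation.Binary.PropositionalEquality using (_≡_; _≢_)

digitSum : ℕ → List (ℕ × ℕ) → ℕ
digitSum g ps = sum (map (λ p → proj₂ p * g ^ proj₁ p) ps)

-- n ∈ A_g(W): there is a finite nonempty set F ⊆ W (a list of pairwise distinct
-- exponents), with coefficients 1 ≤ a_f ≤ g-1, such that n = Σ a_f g^f.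
InA : (g : ℕ) → (W : ℕ → Set) → ℕ → Set
InA g W n =
  Σ (List (ℕ × ℕ)) λ ps →
    (ps ≢ []) ×
    Unique (map proj₁ ps) ×
    All (λ p → W (proj₁ p) × (1 ≤ proj₂ p) × (proj₂ p ≤ g ∸ 1)) ps ×
    (n ≡ digitSum g ps)

InSumset : (h : ℕ) → (B : ℕ → Set) → ℕ → Set
InSumset h B n =
  Σ (Vec ℕ h) λ bs → VAll B bs × (n ≡ vsum bs)

InfManyIntervals : (W : ℕ → Set) → ℕ → Set
InfManyIntervals W t =
  (M : ℕ) → ∃ λ m → (M ≤ m) × ((i : Fin t) → W (m + toℕ i))

{-# OPTIONS --safe #-}
-- Cut ℕ into blocks of length P = 2t + 2. The first L = t + 2 positions of every block form W₀;
-- the last t positions of the i-th block go to W_r with r = 1 + (i mod (h - 1)). For G = g^P and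
-- C = g^L - 2 we have G ≤ h·C, since h > g^t (g - 1) ≥ g^t. So the residue of q mod G splits into
-- h parts ≤ C, each with base-g digits in the first L positions, and by induction the quotient
-- q / G is a sum of h numbers with digits in W₀; shifting these by P positions and adding the
-- parts writes q as a sum of h such numbers. For n ≥ h apply this to n - h and add 1 to each part,
-- which makes every summand nonzero, i.e. an element of A_g(W₀).
module Submission where

open import Defs
open import Level using (0ℓ)
open import Data.Nat using (>-nonZero; ℕ; zero; suc; _+_; _*_; _^_; _∸_; _≤_; _<_; z≤n; s≤s; s≤s⁻¹; NonZero; _<?_; _%_; _/_)
open import Data.Nat.Properties
open import Data.Nat.DivMod
open import Data.Nat.Divisibility using (n∣m*n)
open import Data.Nat.Induction using (<-rec)
open import Data.Nat.ListAction using (sum)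
open import Data.Nat.ListAction.Properties using (sum-++)
open import Algebra.Properties.CommutativeSemigroup +-commutativeSemigroup using (x∙yz≈y∙xz)
open import Data.Nat.Solver using (module +-*-Solver)
open import Data.Product using (Σ; _×_; _,_; proj₁; proj₂)
open import Data.Sum using (inj₁; inj₂)
open import Data.Fin using (toℕ)
open import Data.Fin.Properties using (toℕ<n)
open import Data.List using (List; []; _∷_; map; _++_)
open import Data.List.Properties using (map-++; map-∘)
open import Data.List.Relation.Unary.All as All using (All; []; _∷_)
import Data.List.Relation.Unary.All.Properties as All
open import Data.List.Relation.Unary.AllPairs using ([]; _∷_)
open import Data.List.Relation.Unary.Unique.Propositional using (Unique)
import Data.List.Relation.Unary.Unique.Propositional.Properties as Unique
open import Data.Vec using (Vec; []; _∷_; zipWith) renaming (sum to vsum; map to vmap)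
open import Data.Vec.Relation.Unary.All as VAll using ([]; _∷_) renaming (All to VAll)
import Data.Vec.Relation.Unary.All.Properties as VAll
open import Relation.Binary.PropositionalEquality
open import Relation.Nullary using (yes; no; contradiction)
open import Relation.Unary using (Pred; _⊆_; _∪_; _⊥_)

open +-*-Solver using (solve; _:+_; _:*_; _:=_; con)

sumset-∷ : ∀ {k b x} {B : Pred ℕ 0ℓ} → B b → InSumset k B x → InSumset (suc k) B (b + x)
sumset-∷ b (xs , ps , refl) = _ ∷ xs , b ∷ ps , refl

sumset-zero : ∀ {B : Pred ℕ 0ℓ} k → B 0 → InSumset k B 0
sumset-zero zero    b = [] , [] , refl
sumset-zero (suc k) b = sumset-∷ b (sumset-zero k b)

sumset-≤ : ∀ k {c V} → V ≤ k * c → InSumset k (_≤ c) V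
sumset-≤ zero    V≤0 = [] , [] , n≤0⇒n≡0 V≤0
sumset-≤ (suc k) {c} {V} V≤ with V ≤? c
... | yes V≤c = subst (InSumset _ _) (+-identityʳ V) (sumset-∷ V≤c (sumset-zero k z≤n))
... | no  V≰c = subst (InSumset _ _) (m+[n∸m]≡n (<⇒≤ (≰⇒> V≰c)))
                  (sumset-∷ ≤-refl (sumset-≤ k (m≤n+o⇒m∸n≤o V c V≤)))

vsum-map-suc : ∀ {k} (xs : Vec ℕ k) → vsum (vmap suc xs) ≡ k + vsum xs
vsum-map-suc         []       = refl
vsum-map-suc {suc k} (x ∷ xs) = cong suc (trans (cong (x +_) (vsum-map-suc xs)) (x∙yz≈y∙xz x k (vsum xs)))

sumset-suc : ∀ {k c x} → InSumset k (_≤ c) x → InSumset k (λ y → 1 ≤ y × y ≤ suc c) (k + x)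
sumset-suc (xs , ps , refl) =
  vmap suc xs , VAll.map⁺ (VAll.map (λ p → s≤s z≤n , s≤s p) ps) , sym (vsum-map-suc xs)

vsum-zipWith-+* : ∀ {k} G (xs ys : Vec ℕ k) →
  vsum (zipWith (λ x y → x + G * y) xs ys) ≡ vsum xs + G * vsum ys
vsum-zipWith-+* G []       []       = sym (*-zeroʳ G)
vsum-zipWith-+* G (x ∷ xs) (y ∷ ys) =
  trans (cong (x + G * y +_) (vsum-zipWith-+* G xs ys)) (regroup x y (vsum xs) (vsum ys) G)
  where
  regroup : ∀ x y X Y G → x + G * y + (X + G * Y) ≡ x + X + G * (y + Y)
  regroup = solve 5 (λ x y X Y G → x :+ G :* y :+ (X :+ G :* Y) := x :+ X :+ G :* (y :+ Y)) refl

sumset-+* : ∀ {k x y} {B B′ B″ : Pred ℕ 0ℓ} G → (∀ {a b} → B a → B′ b → B″ (a + G * b)) →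
  InSumset k B x → InSumset k B′ y → InSumset k B″ (x + G * y)
sumset-+* G combine (xs , ps , refl) (ys , qs , refl) =
  zipWith (λ x y → x + G * y) xs ys , VAll.zipWith combine ps qs , sym (vsum-zipWith-+* G xs ys)

-- The base is g = suc g₁, so that the digit bound g₁ is definitionally the g ∸ 1 of InA.
module BaseExpansion (g₁ : ℕ) where

  g : ℕ
  g = suc g₁

  Digit : Pred ℕ 0ℓ → Pred (ℕ × ℕ) 0ℓ
  Digit Q p = Q (proj₁ p) × 1 ≤ proj₂ p × proj₂ p ≤ g₁

  Expansion : Pred ℕ 0ℓ → Pred ℕ 0ℓ
  Expansion Q x = Σ (List (ℕ × ℕ)) λ ps → Unique (map proj₁ ps) × All (Digit Q) ps × x ≡ digitSum g ps

  shift : ℕ → List (ℕ × ℕ) → List (ℕ × ℕ)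
  shift s = map (λ p → s + proj₁ p , proj₂ p)

  digitSum-++ : ∀ ps qs → digitSum g (ps ++ qs) ≡ digitSum g ps + digitSum g qs
  digitSum-++ ps qs = trans (cong sum (map-++ term ps qs)) (sum-++ (map term ps) (map term qs))
    where
    term : ℕ × ℕ → ℕ
    term p = proj₂ p * g ^ proj₁ p

  digitSum-shift : ∀ s ps → digitSum g (shift s ps) ≡ g ^ s * digitSum g ps
  digitSum-shift s []             = sym (*-zeroʳ (g ^ s))
  digitSum-shift s ((f , a) ∷ ps) = begin
    a * g ^ (s + f) + digitSum g (shift s ps)   ≡⟨ cong₂ _+_ (cong (a *_) (^-distribˡ-+-* g s f)) (digitSum-shift s ps) ⟩
    a * (g ^ s * g ^ f) + g ^ s * digitSum g ps ≡⟨ factor a (g ^ s) (g ^ f) (digitSum g ps) ⟩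
    g ^ s * (a * g ^ f + digitSum g ps)         ∎
    where
    open ≡-Reasoning
    factor : ∀ a S F D → a * (S * F) + S * D ≡ S * (a * F + D)
    factor = solve 4 (λ a S F D → a :* (S :* F) :+ S :* D := S :* (a :* F :+ D)) refl

  positions : ∀ {Q ps} → All (Digit Q) ps → All Q (map proj₁ ps)
  positions ds = All.map⁺ (All.map proj₁ ds)

  expansion-zero : ∀ {Q} → Expansion Q 0
  expansion-zero = [] , [] , [] , refl

  expansion-digit : ∀ {d} → d ≤ g₁ → Expansion (_≡ 0) d
  expansion-digit {zero}  _   = expansion-zero
  expansion-digit {suc d} d≤g₁ =
    (0 , suc d) ∷ [] , [] ∷ [] , (refl , s≤s z≤n , d≤g₁) ∷ [] ,
    sym (trans (+-identityʳ _) (*-identityʳ _))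

  expansion-mono : ∀ {Q R} → Q ⊆ R → Expansion Q ⊆ Expansion R
  expansion-mono Q⊆R (ps , u , ds , e) = ps , u , All.map (λ (q , d) → Q⊆R q , d) ds , e

  expansion-shift : ∀ {Q R y} s → (∀ {k} → Q k → R (s + k)) → Expansion Q y → Expansion R (g ^ s * y)
  expansion-shift s Q⇒R (ps , u , ds , refl) =
    shift s ps ,
    subst Unique (trans (sym (map-∘ ps)) (map-∘ ps)) (Unique.map⁺ (+-cancelˡ-≡ s _ _) u) ,
    All.map⁺ (All.map (λ (q , d) → Q⇒R q , d) ds) ,
    sym (digitSum-shift s ps)

  expansion-+ : ∀ {Q R x y} → Q ⊥ R → Expansion Q x → Expansion R y → Expansion (Q ∪ R) (x + y)
  expansion-+ Q⊥R (ps , u , ds , refl) (qs , v , es , refl) =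
    ps ++ qs ,
    subst Unique (sym (map-++ proj₁ ps qs))
      (Unique.++⁺ u v (λ (i , j) → Q⊥R (All.lookup (positions ds) i , All.lookup (positions es) j))) ,
    All.++⁺ (All.map (λ (q , d) → inj₁ q , d) ds) (All.map (λ (r , d) → inj₂ r , d) es) ,
    sym (digitSum-++ ps qs)

  expansion-< : ∀ L {x} → x < g ^ L → Expansion (_< L) x
  expansion-< zero    {zero}  _        = expansion-zero
  expansion-< zero    {suc _} (s≤s ())
  expansion-< (suc L) {x} x<gᴸ⁺¹ =
    subst (Expansion (_< suc L)) (sym x≡digit+g*quotient)
      (expansion-mono (λ { (inj₁ refl) → s≤s z≤n ; (inj₂ (_ , k≤L)) → s≤s k≤L })
        (expansion-+ (λ { (refl , () , _) })
          (expansion-digit (s≤s⁻¹ (m%n<n x g)))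
          (expansion-shift {R = λ k → 1 ≤ k × k ≤ L} 1 (λ k<L → s≤s z≤n , k<L)
            (expansion-< L (m<n*o⇒m/o<n (subst (x <_) (*-comm g (g ^ L)) x<gᴸ⁺¹))))))
    where
    x≡digit+g*quotient : x ≡ x % g + g ^ 1 * (x / g)
    x≡digit+g*quotient = trans (m≡m%n+[m/n]*n x g)
      (cong (x % g +_) (trans (*-comm (x / g) g) (cong (_* (x / g)) (sym (*-identityʳ g)))))

  expansion⇒InA : ∀ {Q x} → Expansion Q x → 0 < x → InA g Q x
  expansion⇒InA ([]     , _ , _  , refl) ()
  expansion⇒InA (p ∷ ps , u , ds , e)    _ = p ∷ ps , (λ ()) , u , ds , e

module PeriodicSupport
  (g₁ h L P C : ℕ) (W : Pred ℕ 0ℓ)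
  (L≤P : L ≤ P) (W-initial : ∀ {k} → k < L → W k) (W-periodic : ∀ {k} → W k → W (P + k))
  (1+C<gᴸ : suc C < suc g₁ ^ L) (gᴾ≤hC : suc g₁ ^ P ≤ h * C)
  where

  open BaseExpansion g₁

  G : ℕ
  G = g ^ P

  instance
    G≢0 : NonZero G
    G≢0 = m^n≢0 g P

  1<G : 1 < G
  1<G = <-≤-trans (≤-<-trans (s≤s z≤n) 1+C<gᴸ) (^-monoʳ-≤ g L≤P)

  q≡q%G+G*q/G : ∀ q → q ≡ q % G + G * (q / G)
  q≡q%G+G*q/G q = trans (m≡m%n+[m/n]*n q G) (cong (q % G +_) (*-comm (q / G) G))

  expansion-block : ∀ {x y} → x < g ^ L → Expansion W y → Expansion W (x + G * y)
  expansion-block x<gᴸ ey =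
    expansion-mono (λ { (inj₁ k<L) → W-initial k<L ; (inj₂ (_ , w)) → w })
      (expansion-+ (λ (k<L , P≤k , _) → <-irrefl refl (<-≤-trans k<L (≤-trans L≤P P≤k)))
        (expansion-< L x<gᴸ)
        (expansion-shift {R = λ k → P ≤ k × W k} P (λ w → m≤m+n P _ , W-periodic w) ey))

  low-digits : ∀ q → InSumset h (_≤ C) (q % G)
  low-digits q = sumset-≤ h (≤-trans (<⇒≤ (m%n<n q G)) gᴾ≤hC)

  sum-of-expansions : ∀ q → InSumset h (Expansion W) q
  sum-of-expansions = <-rec _ step
    where
    step : ∀ q → (∀ {p} → p < q → InSumset h (Expansion W) p) → InSumset h (Expansion W) q
    step zero      _   = sumset-zero h expansion-zero
    step q@(suc _) rec =
      subst (InSumset h (Expansion W)) (sym (q≡q%G+G*q/G q))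
        (sumset-+* G (λ x≤C → expansion-block (≤-<-trans x≤C (<-trans (n<1+n C) 1+C<gᴸ)))
          (low-digits q) (rec (m/n<m q G 1<G)))

  sumset : ∀ n → h ≤ n → InSumset h (InA g W) n
  sumset n h≤n =
    subst (InSumset h (InA g W)) n≡h+r
      (sumset-+* G (λ (1≤x , x≤1+C) ey →
                      expansion⇒InA (expansion-block (≤-<-trans x≤1+C 1+C<gᴸ) ey) (≤-trans 1≤x (m≤m+n _ _)))
        (sumset-suc (low-digits r)) (sum-of-expansions (r / G)))
    where
    r : ℕ
    r = n ∸ h
    n≡h+r : h + r % G + G * (r / G) ≡ n
    n≡h+r = begin
      h + r % G + G * (r / G)   ≡⟨ +-assoc h _ _ ⟩
      h + (r % G + G * (r / G)) ≡⟨ cong (h +_) (sym (q≡q%G+G*q/G r)) ⟩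
      h + r                     ≡⟨ m+[n∸m]≡n h≤n ⟩
      n                         ∎
      where open ≡-Reasoning

module BlockColouring (L t m : ℕ) {{_ : NonZero (L + t)}} where

  P : ℕ
  P = L + t

  colour : ℕ → ℕ
  colour k with k % P <? L
  ... | yes _ = 0
  ... | no  _ = suc (k / P % suc m)

  colour-< : ∀ k → colour k < 2 + m
  colour-< k with k % P <? L
  ... | yes _ = s≤s z≤n
  ... | no  _ = s≤s (m%n<n (k / P) (suc m))

  colour-low : ∀ {k} → k % P < L → colour k ≡ 0
  colour-low {k} low with k % P <? L
  ... | yes _    = refl
  ... | no  ¬low = contradiction low ¬low

  colour-high : ∀ {k} → L ≤ k % P → colour k ≡ suc (k / P % suc m)
  colour-high {k} high with k % P <? L
  ... | yes low = contradiction high (<⇒≱ low)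
  ... | no  _   = refl

  colour≡0⇒low : ∀ {k} → colour k ≡ 0 → k % P < L
  colour≡0⇒low {k} c≡0 with k % P <? L
  colour≡0⇒low      _  | yes low = low
  colour≡0⇒low      () | no  _

  block-% : ∀ i {s} → s < P → (i * P + s) % P ≡ s
  block-% i {s} s<P = trans (cong (_% P) (+-comm (i * P) s)) (trans ([m+kn]%n≡m%n s i P) (m<n⇒m%n≡m s<P))

  block-/ : ∀ i {s} → s < P → (i * P + s) / P ≡ i
  block-/ i {s} s<P = begin
    (i * P + s) / P    ≡⟨ +-distrib-/-∣ˡ s (n∣m*n i) ⟩
    i * P / P + s / P  ≡⟨ cong₂ _+_ (m*n/n≡m i P) (m<n⇒m/n≡0 s<P) ⟩
    i + 0              ≡⟨ +-identityʳ i ⟩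
    i                  ∎
    where open ≡-Reasoning

  colour-block-low : ∀ i {s} → s < L → colour (i * P + s) ≡ 0
  colour-block-low i s<L = colour-low (subst (_< L) (sym (block-% i (<-≤-trans s<L (m≤m+n L t)))) s<L)

  colour-block-high : ∀ i {s} → L ≤ s → s < P → colour (i * P + s) ≡ suc (i % suc m)
  colour-block-high i L≤s s<P = trans (colour-high (subst (L ≤_) (sym (block-% i s<P)) L≤s))
                                      (cong (λ j → suc (j % suc m)) (block-/ i s<P))

  colour-periodic : ∀ {k} → colour k ≡ 0 → colour (P + k) ≡ 0
  colour-periodic {k} c≡0 =
    colour-low (subst (_< L) (sym (trans (cong (_% P) (+-comm P k)) ([m+n]%n≡m%n k P))) (colour≡0⇒low c≡0))

  colour-intervals : t ≤ L → ∀ r → r < 2 + m → InfManyIntervals (λ n → colour n ≡ r) t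
  colour-intervals t≤L zero _ M =
    M * P , m≤m*n M P , λ j → colour-block-low M (<-≤-trans (toℕ<n j) t≤L)
  colour-intervals t≤L (suc r) (s≤s r<1+m) M =
    i * P + L , M≤iP+L , λ j →
      trans (cong colour (+-assoc (i * P) L (toℕ j)))
        (trans (colour-block-high i (m≤m+n L (toℕ j)) (+-monoʳ-< L (toℕ<n j)))
          (cong suc (trans ([m+kn]%n≡m%n r M (suc m)) (m<n⇒m%n≡m r<1+m))))
    where
    i : ℕ
    i = r + M * suc m
    M≤iP+L : M ≤ i * P + L
    M≤iP+L = ≤-trans (m≤m*n M (suc m)) (≤-trans (m≤n+m _ r) (≤-trans (m≤m*n i P) (m≤m+n _ L)))

capacity : ∀ {a c h} → 2 * a ≤ c → a < h → (c + 2) * a ≤ h * c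
capacity {a} {c} {h} 2a≤c a<h = begin
  (c + 2) * a    ≡⟨ expand c a ⟩
  a * c + 2 * a  ≤⟨ +-monoʳ-≤ (a * c) 2a≤c ⟩
  a * c + c      ≡⟨ +-comm (a * c) c ⟩
  suc a * c      ≤⟨ *-monoˡ-≤ c a<h ⟩
  h * c          ∎
  where
  open ≤-Reasoning
  expand : ∀ c a → (c + 2) * a ≡ a * c + 2 * a
  expand = solve 2 (λ c a → (c :+ con 2) :* a := a :* c :+ con 2 :* a) refl

module BlockSizes (g t : ℕ) (2≤g : 2 ≤ g) where

  L P C : ℕ
  L = 2 + t
  P = L + t
  C = g ^ L ∸ 2

  1≤gᵗ : 1 ≤ g ^ t
  1≤gᵗ = m^n>0 g {{>-nonZero (≤-trans (s≤s z≤n) 2≤g)}} t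

  2gᵗ+2≤gᴸ : 2 * g ^ t + 2 ≤ g ^ L
  2gᵗ+2≤gᴸ = begin
    2 * g ^ t + 2           ≤⟨ +-monoʳ-≤ (2 * g ^ t) (*-monoʳ-≤ 2 1≤gᵗ) ⟩
    2 * g ^ t + 2 * g ^ t   ≡⟨ cong (2 * g ^ t +_) (+-identityʳ (2 * g ^ t)) ⟨
    2 * (2 * g ^ t)         ≤⟨ *-mono-≤ 2≤g (*-mono-≤ 2≤g ≤-refl) ⟩
    g ^ L                   ∎
    where open ≤-Reasoning

  C+2≡gᴸ : C + 2 ≡ g ^ L
  C+2≡gᴸ = m∸n+n≡m (≤-trans (m≤n+m 2 (2 * g ^ t)) 2gᵗ+2≤gᴸ)

  1+C<gᴸ : suc C < g ^ L
  1+C<gᴸ = ≤-reflexive (trans (+-comm 2 C) C+2≡gᴸ)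

  gᴾ≤hC : ∀ {h} → g ^ t < h → g ^ P ≤ h * C
  gᴾ≤hC {h} gᵗ<h = begin
    g ^ P           ≡⟨ ^-distribˡ-+-* g L t ⟩
    g ^ L * g ^ t   ≡⟨ cong (_* g ^ t) C+2≡gᴸ ⟨
    (C + 2) * g ^ t ≤⟨ capacity 2gᵗ≤C gᵗ<h ⟩
    h * C           ∎
    where
    open ≤-Reasoning
    2gᵗ≤C : 2 * g ^ t ≤ C
    2gᵗ≤C = +-cancelʳ-≤ 2 (2 * g ^ t) C (subst (2 * g ^ t + 2 ≤_) (sym C+2≡gᴸ) 2gᵗ+2≤gᴸ)

theorem2 : (g h t : ℕ) → 2 ≤ g → 2 ≤ h → 1 ≤ t → g ^ t * (g ∸ 1) < h →
    Σ (ℕ → ℕ) λ c →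
      ((n : ℕ) → c n < h) ×
      ((r : ℕ) → r < h → InfManyIntervals (λ n → c n ≡ r) t) ×
      ((n : ℕ) → h ≤ n → InSumset h (InA g (λ k → c k ≡ 0)) n)
theorem2 g@(suc g₁) h@(suc (suc h₂)) t 2≤g@(s≤s (s≤s _)) (s≤s (s≤s _)) _ gᵗ[g-1]<h =
  colour , colour-< , colour-intervals (m≤n+m t 2) , sumset
  where
  open BlockSizes g t 2≤g
  open BlockColouring L t h₂ hiding (P)
  open PeriodicSupport g₁ h L P C (λ k → colour k ≡ 0) (m≤m+n L t)
    (colour-block-low 0) colour-periodic 1+C<gᴸ (gᴾ≤hC (≤-<-trans (m≤m*n (g ^ t) g₁) gᵗ[g-1]<h))
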